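{- Let $n,a,k,r$ be integers with $k,r\geq 2$ and $n\geq a\geq t$, where $t=t(k,r)$. Then (i) $\binom{n}{r}\geq (n-1)k-\left((t-1)k-\binom{t}{r}\right)\left\lfloor\frac{n}{t}\right\rfloor$; (ii) $\binom{n}{r}\geq (n-a)k+\binom{a}{r}-\left((t-1)k-\binom{t}{r}\right)\left\lfloor\frac{n-a}{t}\right\rfloor$.
   Context: Binomial coefficients satisfy $\binom{m}{j}=0$ when $j>m$. For integers $k,r\geq2$, $t=t(k,r)$ is the integer with $\binom{t-1}{r-1}\leq k<\binom{t}{r-1}$ (the largest integer with $\binom{t-1}{r-1}\le k$). -}

module Defs where

open import Data.Nat using (ℕ; _≤_; _<_; _∸_)
open import Data.Nat.Combinatorics using (_C_)
open import Data.Product using (_×_)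

-- t = t(k,r): the integer with  C(t-1, r-1) ≤ k < C(t, r-1).
-- (For t = 0 the second inequality would read k < C(0,r-1) = 0 when r ≥ 2,
--  so truncated subtraction t ∸ 1 introduces no spurious solution.)
IsT : ℕ → ℕ → ℕ → Set
IsT k r t = ((t ∸ 1) C (r ∸ 1) ≤ k) × (k < t C (r ∸ 1))

module Submission where

open import Defs
open import Data.Nat using (ℕ; _≤_; _∸_; _/_; NonZero)
open import Data.Nat.Combinatorics using (_C_)
open import Data.Integer using (+_; _+_; _-_; _*_; _≥_)
open import Data.Product using (_×_)

open import Data.Nat as ℕ using (zero; suc; z≤n; s≤s; _≤′_; ≤′-refl; ≤′-step)
import Data.Nat.Properties as ℕ
import Data.Integer as ℤ
import Data.Integer.Properties as ℤ
open import Data.Nat.Combinatorics using (nCk+nC[k+1]≡[n+1]C[k+1]; k>n⇒nCk≡0)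
open import Data.Nat.DivMod using (m≥n⇒m/n>0)
open import Data.Product using (_,_)
open import Relation.Binary.PropositionalEquality

-- Write r = s + 2. By Pascal's rule C(m+1, r) = C(m, r) + C(m, r-1), and C(m, r-1) ≥ C(t, r-1) > k
-- for m ≥ t, so beyond t the map m ↦ C(m, r) grows by at least k per step: C(n, r) ≥ (n-a)k + C(a, r).
-- Unrolling Pascal's rule down to 0 gives C(t, r) ≤ (t-1) C(t-1, r-1) ≤ (t-1) k, so the defect
-- D = (t-1)k - C(t, r) is a natural number. Then (ii) is the growth bound minus D⌊(n-a)/t⌋ ≥ 0,
-- and (i) is its case a = t, as (n-1)k - D = (n-t)k + C(t, r) and D⌊n/t⌋ ≥ D.

pascal : ∀ m s → suc m C suc s ≡ m C s ℕ.+ m C suc s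
pascal m s = sym (nCk+nC[k+1]≡[n+1]C[k+1] m s)

C-monoˡ-≤′ : ∀ s {m n} → m ≤′ n → m C s ≤ n C s
C-monoˡ-≤′ s ≤′-refl = ℕ.≤-refl
C-monoˡ-≤′ zero (≤′-step m≤′n) = C-monoˡ-≤′ zero m≤′n
C-monoˡ-≤′ (suc s) {n = suc n} (≤′-step m≤′n) rewrite pascal n s =
  ℕ.≤-trans (C-monoˡ-≤′ (suc s) m≤′n) (ℕ.m≤n+m (n C suc s) (n C s))

C-monoˡ-≤ : ∀ s {m n} → m ≤ n → m C s ≤ n C s
C-monoˡ-≤ s m≤n = C-monoˡ-≤′ s (ℕ.≤⇒≤′ m≤n)

d*k+aC[1+s]≤[d+a]C[1+s] : ∀ {k a} s → k ≤ a C s → ∀ d →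
                          d ℕ.* k ℕ.+ a C suc s ≤ (d ℕ.+ a) C suc s
d*k+aC[1+s]≤[d+a]C[1+s] s k≤aCs zero = ℕ.≤-refl
d*k+aC[1+s]≤[d+a]C[1+s] {k} {a} s k≤aCs (suc d) = begin
  k ℕ.+ d ℕ.* k ℕ.+ a C suc s         ≡⟨ ℕ.+-assoc k (d ℕ.* k) _ ⟩
  k ℕ.+ (d ℕ.* k ℕ.+ a C suc s)       ≤⟨ ℕ.+-mono-≤ k≤[d+a]Cs (d*k+aC[1+s]≤[d+a]C[1+s] s k≤aCs d) ⟩
  (d ℕ.+ a) C s ℕ.+ (d ℕ.+ a) C suc s ≡⟨ pascal (d ℕ.+ a) s ⟨
  suc (d ℕ.+ a) C suc s               ∎
  where
  open ℕ.≤-Reasoning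
  k≤[d+a]Cs : k ≤ (d ℕ.+ a) C s
  k≤[d+a]Cs = ℕ.≤-trans k≤aCs (C-monoˡ-≤ s (ℕ.m≤n+m a d))

[n∸a]*k+aC[1+s]≤nC[1+s] : ∀ {k a n} s → k ≤ a C s → a ≤ n →
                          (n ∸ a) ℕ.* k ℕ.+ a C suc s ≤ n C suc s
[n∸a]*k+aC[1+s]≤nC[1+s] {k} {a} {n} s k≤aCs a≤n =
  subst (λ m → (n ∸ a) ℕ.* k ℕ.+ a C suc s ≤ m C suc s) (ℕ.m∸n+n≡m a≤n)
        (d*k+aC[1+s]≤[d+a]C[1+s] s k≤aCs (n ∸ a))

[1+j]C[2+s]≤j*jC[1+s] : ∀ s j → suc j C suc (suc s) ≤ j ℕ.* (j C suc s)
[1+j]C[2+s]≤j*jC[1+s] s zero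
  rewrite pascal 0 (suc s) | k>n⇒nCk≡0 {0} {suc s} (s≤s z≤n)
        | k>n⇒nCk≡0 {0} {suc (suc s)} (s≤s z≤n) = z≤n
[1+j]C[2+s]≤j*jC[1+s] s (suc j) = begin
  suc (suc j) C suc (suc s)                 ≡⟨ pascal (suc j) (suc s) ⟩
  suc j C suc s ℕ.+ suc j C suc (suc s)     ≤⟨ ℕ.+-monoʳ-≤ (suc j C suc s) ([1+j]C[2+s]≤j*jC[1+s] s j) ⟩
  suc j C suc s ℕ.+ j ℕ.* (j C suc s)       ≤⟨ ℕ.+-monoʳ-≤ (suc j C suc s) (ℕ.*-monoʳ-≤ j jCs≤[1+j]Cs) ⟩
  suc j C suc s ℕ.+ j ℕ.* (suc j C suc s)   ≡⟨⟩
  suc j ℕ.* (suc j C suc s)                 ∎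
  where
  open ℕ.≤-Reasoning
  jCs≤[1+j]Cs : j C suc s ≤ suc j C suc s
  jCs≤[1+j]Cs = C-monoˡ-≤ (suc s) (ℕ.n≤1+n j)

[n∸1]*k≡[n∸1+t]*k+c+[t*k∸c] : ∀ {n t c} k → suc t ≤ n → c ≤ t ℕ.* k →
                              (n ∸ 1) ℕ.* k ≡ (n ∸ suc t) ℕ.* k ℕ.+ c ℕ.+ (t ℕ.* k ∸ c)
[n∸1]*k≡[n∸1+t]*k+c+[t*k∸c] {n} {t} {c} k t<n c≤t*k = begin
  (n ∸ 1) ℕ.* k                           ≡⟨ cong (λ m → (m ∸ 1) ℕ.* k) (ℕ.m∸n+n≡m t<n) ⟨
  (d ℕ.+ suc t ∸ 1) ℕ.* k                 ≡⟨ cong (ℕ._* k) (ℕ.+-∸-assoc d {suc t} (s≤s z≤n)) ⟩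
  (d ℕ.+ t) ℕ.* k                         ≡⟨ ℕ.*-distribʳ-+ k d t ⟩
  d ℕ.* k ℕ.+ t ℕ.* k                     ≡⟨ cong (d ℕ.* k ℕ.+_) (ℕ.m+[n∸m]≡n c≤t*k) ⟨
  d ℕ.* k ℕ.+ (c ℕ.+ (t ℕ.* k ∸ c))       ≡⟨ ℕ.+-assoc (d ℕ.* k) c _ ⟨
  d ℕ.* k ℕ.+ c ℕ.+ (t ℕ.* k ∸ c)         ∎
  where
  open ≡-Reasoning
  d = n ∸ suc t

m≤m*[n/d] : ∀ m {n d} .{{_ : NonZero d}} → d ≤ n → m ≤ m ℕ.* (n / d)
m≤m*[n/d] m {n} {d} d≤n =
  subst (_≤ m ℕ.* (n / d)) (ℕ.*-identityʳ m) (ℕ.*-monoʳ-≤ m (m≥n⇒m/n>0 d≤n))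

pos-∸ : ∀ {m n} → n ≤ m → + (m ∸ n) ≡ + m - + n
pos-∸ {m} {n} n≤m = sym (trans (ℤ.[+m]-[+n]≡m⊖n m n) (ℤ.⊖-≥ n≤m))

[1+t-1]*k-c≡t*k∸c : ∀ {t k c} → c ≤ t ℕ.* k → (+ suc t - + 1) * + k - + c ≡ + (t ℕ.* k ∸ c)
[1+t-1]*k-c≡t*k∸c {t} {k} {c} c≤t*k = begin
  (+ suc t - + 1) * + k - + c ≡⟨ cong (λ z → z * + k - + c) (pos-∸ {suc t} (s≤s z≤n)) ⟨
  + t * + k - + c             ≡⟨ cong (_- + c) (ℤ.pos-* t k) ⟨
  + (t ℕ.* k) - + c           ≡⟨ pos-∸ c≤t*k ⟨
  + (t ℕ.* k ∸ c)             ∎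
  where open ≡-Reasoning

m≤n+o⇒m-o≤n : ∀ {a b c} → a ≤ b ℕ.+ c → + a - + c ℤ.≤ + b
m≤n+o⇒m-o≤n {a} {b} {c} a≤b+c = begin
  + a - + c       ≡⟨ ℤ.[+m]-[+n]≡m⊖n a c ⟩
  a ℤ.⊖ c         ≤⟨ ℤ.⊖-monoˡ-≤ c a≤b+c ⟩
  (b ℕ.+ c) ℤ.⊖ c ≡⟨ ℤ.⊖-≥ (ℕ.m≤n+m c b) ⟩
  + (b ℕ.+ c ∸ c) ≡⟨ cong +_ (ℕ.m+n∸n≡m b c) ⟩
  + b             ∎
  where open ℤ.≤-Reasoning

lemma4p1 : (n a k r t : ℕ) → 2 ≤ k → 2 ≤ r → IsT k r t → .{{_ : NonZero t}} →
             t ≤ a → a ≤ n →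
             ((+ (n C r)) ≥ (+ n - + 1) * + k - ((+ t - + 1) * + k - + (t C r)) * + (n / t))
             × ((+ (n C r)) ≥ + (n ∸ a) * + k + + (a C r) - ((+ t - + 1) * + k - + (t C r)) * + ((n ∸ a) / t))
lemma4p1 _ _ _ (suc zero) _ _ (s≤s ()) _ _ _
lemma4p1 n a k (suc (suc s)) t@(suc t₀) _ _ (C[t-1,r-1]≤k , k<C[t,r-1]) t≤a a≤n =
  subst (+ (n C r) ℤ.≥_) (sym (cong₂ _-_ [n-1]*k≡ ([[t-1]*k-tCr]*q≡D*q (n / t))))
        (m≤n+o⇒m-o≤n (ℕ.≤-trans [n∸1]*k≤nCr+D (ℕ.+-monoʳ-≤ (n C r) (m≤m*[n/d] D t≤n)))) ,
  subst (+ (n C r) ℤ.≥_) (sym (cong₂ _-_ [n-a]*k+aCr≡ ([[t-1]*k-tCr]*q≡D*q ((n ∸ a) / t))))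
        (m≤n+o⇒m-o≤n (ℕ.≤-trans ([n∸a]*k+aC[1+s]≤nC[1+s] (suc s) k≤aC[r-1] a≤n)
                                   (ℕ.m≤m+n (n C r) (D ℕ.* ((n ∸ a) / t)))))
  where
  r : ℕ
  r = suc (suc s)

  t≤n : t ≤ n
  t≤n = ℕ.≤-trans t≤a a≤n

  k≤aC[r-1] : k ≤ a C suc s
  k≤aC[r-1] = ℕ.≤-trans (ℕ.<⇒≤ k<C[t,r-1]) (C-monoˡ-≤ (suc s) t≤a)

  tCr≤t₀*k : t C r ≤ t₀ ℕ.* k
  tCr≤t₀*k = ℕ.≤-trans ([1+j]C[2+s]≤j*jC[1+s] s t₀) (ℕ.*-monoʳ-≤ t₀ C[t-1,r-1]≤k)

  D : ℕ
  D = t₀ ℕ.* k ∸ t C r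

  [n∸1]*k≤nCr+D : (n ∸ 1) ℕ.* k ≤ n C r ℕ.+ D
  [n∸1]*k≤nCr+D = ℕ.≤-trans (ℕ.≤-reflexive ([n∸1]*k≡[n∸1+t]*k+c+[t*k∸c] k t≤n tCr≤t₀*k))
                            (ℕ.+-monoˡ-≤ D ([n∸a]*k+aC[1+s]≤nC[1+s] (suc s) (ℕ.<⇒≤ k<C[t,r-1]) t≤n))

  [[t-1]*k-tCr]*q≡D*q : ∀ q → ((+ t - + 1) * + k - + (t C r)) * + q ≡ + (D ℕ.* q)
  [[t-1]*k-tCr]*q≡D*q q = trans (cong (_* + q) ([1+t-1]*k-c≡t*k∸c {t₀} {k} tCr≤t₀*k)) (sym (ℤ.pos-* D q))

  [n-1]*k≡ : (+ n - + 1) * + k ≡ + ((n ∸ 1) ℕ.* k)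
  [n-1]*k≡ = trans (cong (_* + k) (sym (pos-∸ (ℕ.≤-trans (s≤s z≤n) t≤n))))
                   (sym (ℤ.pos-* (n ∸ 1) k))

  [n-a]*k+aCr≡ : + (n ∸ a) * + k + + (a C r) ≡ + ((n ∸ a) ℕ.* k ℕ.+ a C r)
  [n-a]*k+aCr≡ = trans (cong (_+ + (a C r)) (sym (ℤ.pos-* (n ∸ a) k)))
                       (sym (ℤ.pos-+ ((n ∸ a) ℕ.* k) (a C r)))
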